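{- Let $\theta,\kappa\in\mathbb{F}_{q^3}^*$ with $N(\theta)\neq N(\kappa)$, and let $P$ be any point of $\Pi_\kappa$. Then the projection of $\Pi_\theta$ from $P$ onto the line $m_T$, namely $\{PQ\cap m_T: Q\in\Pi_\theta\}$, equals $\mathcal S_{ -\kappa\theta}$.
   Context: Let $q$ be a prime power, $\mathbb{F}_{q^3}^*=\mathbb{F}_{q^3}\setminus\{0\}$, $N(x)=x^{q^2+q+1}$. Points of $\mathrm{PG}(2,q^3)$ have coordinates $(x,y,z)$, lines $[a,b,c]$, incidence iff $ax+by+cz=0$. Let $m_T$ be the line $[0,0,1]$. For $\theta\in\mathbb{F}_{q^3}^*$: $\mathcal S_\theta=\{(x\theta,x^q,0):x\in\mathbb{F}_{q^3}^*\}$ and $\Pi_\theta=\{(r\theta^{q+1},r^q,r^{q^2}\theta):r\in\mathbb{F}_{q^3}^*\}$. -}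

module Defs where

open import Level using (_⊔_)
open import Data.Nat using (ℕ; zero; suc)
open import Data.Product using (Σ; ∃; _×_; _,_)
open import Relation.Nullary using (¬_; Dec)
open import Algebra.Bundles using (CommutativeRing)
open import Function.Bundles using (Bijection)
import Relation.Binary.PropositionalEquality as ≡
open import Data.Fin using (Fin)

module _ {c ℓ} (F : CommutativeRing c ℓ) where
  open CommutativeRing F

  pow : Carrier → ℕ → Carrier
  pow x zero    = 1#
  pow x (suc n) = x * pow x n

  record IsField : Set (c ⊔ ℓ) where
    field
      dec     : ∀ x y → Dec (x ≈ y)
      1≉0     : ¬ (1# ≈ 0#)
      inverse : ∀ x → ¬ (x ≈ 0#) → ∃ λ y → x * y ≈ 1#

  HasSize : ℕ → Set (c ⊔ ℓ)
  HasSize n = Bijection setoid (≡.setoid (Fin n))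

  -- norm N(x) = x^(q^2+q+1) of F_{q^3} over F_q
  Norm : ℕ → Carrier → Carrier
  Norm q x = pow x (q Data.Nat.* q Data.Nat.+ q Data.Nat.+ 1)

  Triple : Set c
  Triple = Carrier × Carrier × Carrier

  NonZeroTriple : Triple → Set ℓ
  NonZeroTriple (x , y , z) = ¬ (x ≈ 0# × y ≈ 0# × z ≈ 0#)

  -- points (and lines) of PG(2, F): nonzero triples, considered up to proportionality
  Point : Set (c ⊔ ℓ)
  Point = Σ Triple NonZeroTriple

  Line : Set (c ⊔ ℓ)
  Line = Σ Triple NonZeroTriple

  Proportional : Triple → Triple → Set (c ⊔ ℓ)
  Proportional (x , y , z) (x' , y' , z') =
    ∃ λ t → ¬ (t ≈ 0#) × (x ≈ t * x') × (y ≈ t * y') × (z ≈ t * z')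

  SamePoint : Point → Point → Set (c ⊔ ℓ)
  SamePoint (u , _) (v , _) = Proportional u v

  Incident : Triple → Point → Set ℓ
  Incident (a , b , c') ((x , y , z) , _) = a * x + b * y + c' * z ≈ 0#

  mT : Triple
  mT = (0# , 0# , 1#)

  IsMeetWithmT : Point → Point → Point → Set (c ⊔ ℓ)
  IsMeetWithmT P Q R =
    ¬ SamePoint P Q × Incident mT R ×
    (∃ λ (L : Line) → Incident (Data.Product.proj₁ L) P × Incident (Data.Product.proj₁ L) Q
                      × Incident (Data.Product.proj₁ L) R)

  InS : ℕ → Carrier → Point → Set (c ⊔ ℓ)
  InS q θ (u , _) = ∃ λ x → ¬ (x ≈ 0#) × Proportional u (x * θ , pow x q , 0#)

  InΠ : ℕ → Carrier → Point → Set (c ⊔ ℓ)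
  InΠ q θ (u , _) = ∃ λ r → ¬ (r ≈ 0#) ×
    Proportional u (r * pow θ (q Data.Nat.+ 1) , pow r q , pow r (q Data.Nat.* q) * θ)

  InProjection : ℕ → Carrier → Point → Point → Set (c ⊔ ℓ)
  InProjection q θ P R = ∃ λ Q → InΠ q θ Q × IsMeetWithmT P Q R

-- Write φ x = x ^ q.  A field with p ^ (3(k+1)) elements has characteristic p, so φ is additive
-- (Frobenius), and φ ∘ φ ∘ φ is the identity (Fermat).  For P = (s φκ κ, φs, φ²s κ) on Π_κ and
-- Q = (r φθ θ, φr, φ²r θ) on Π_θ, eliminating the third coordinate gives PQ ∩ m_T = (-κθ φB, B, 0)
-- with B = φ²s κ φr - φ²r θ φs, which is the point of S_{-κθ} with parameter B⁻¹; B ≠ 0 because P ≠ Q.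
-- Conversely every B ≠ 0 occurs: with z = φr the equation reads a z + b φz = B for a = φ²s κ and
-- b = -θ φs, an F_q-linear system in z, φz, φ²z whose determinant N(a) + N(b) = N(s) (N(κ) - N(θ))
-- is nonzero, so Cramer's rule solves it.

module Submission where

open import Defs
open import Data.Nat using (ℕ; suc; _^_)
open import Data.Nat.Primality using (Prime)
open import Relation.Nullary using (¬_)
open import Algebra.Bundles using (CommutativeRing)
open import Function.Bundles using (_⇔_)

open import Level using (_⊔_)
open import Data.Nat using (zero)
import Data.Nat as ℕ
import Data.Nat.Properties as ℕ
import Data.Integer as ℤ
open import Data.Product using (Σ; ∃; _,_; proj₁; proj₂)
open import Data.Empty using (⊥-elim)
open import Relation.Nullary using (yes; no)
open import Function.Base using (_∘_)
open import Function.Bundles using (mk⇔; Bijection)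
import Relation.Binary.PropositionalEquality as ≡

-- Integer coefficients make the solver's normal forms computable in an arbitrary commutative ring.
module RingSolver {c ℓ} (F : CommutativeRing c ℓ) where

  open CommutativeRing F
  open import Data.Integer using (ℤ; +_; -[1+_]; _⊖_; _◃_)
  import Data.Integer.Properties as ℤ
  import Data.Sign as Sign
  open import Data.Maybe using (Maybe; just; nothing)
  open import Algebra.Solver.Ring.AlmostCommutativeRing
    using (fromCommutativeRing; _-Raw-AlmostCommutative⟶_)
  open import Algebra.Properties.Ring ring
    using (-0#≈0#; -‿involutive; -‿+-comm; -‿distribˡ-*; -‿distribʳ-*)
  open import Algebra.Properties.Semiring.Mult semiring using (_×_; ×-homo-+; ×1-homo-*)
  open import Algebra.Properties.CommutativeSemigroup +-commutativeSemigroup using (interchange)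
  open import Relation.Binary.Reasoning.Setoid setoid

  fromℤ : ℤ → Carrier
  fromℤ (+ n)    = n × 1#
  fromℤ -[1+ n ] = - (suc n × 1#)

  fromℤ-⊖ : ∀ m n → fromℤ (m ⊖ n) ≈ m × 1# - n × 1#
  fromℤ-⊖ m       zero    = sym (trans (+-congˡ -0#≈0#) (+-identityʳ _))
  fromℤ-⊖ zero    (suc n) = sym (+-identityˡ _)
  fromℤ-⊖ (suc m) (suc n) = begin
    fromℤ (suc m ⊖ suc n)              ≡⟨ ≡.cong fromℤ (ℤ.[1+m]⊖[1+n]≡m⊖n m n) ⟩
    fromℤ (m ⊖ n)                      ≈⟨ fromℤ-⊖ m n ⟩
    m × 1# - n × 1#                    ≈⟨ +-identityˡ _ ⟨
    0# + (m × 1# - n × 1#)             ≈⟨ +-congʳ (-‿inverseʳ 1#) ⟨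
    (1# - 1#) + (m × 1# - n × 1#)      ≈⟨ interchange 1# (- 1#) (m × 1#) (- (n × 1#)) ⟩
    (1# + m × 1#) + (- 1# - n × 1#)    ≈⟨ +-congˡ (-‿+-comm 1# (n × 1#)) ⟩
    (1# + m × 1#) - (1# + n × 1#)      ∎

  fromℤ-+ : ∀ i j → fromℤ (i ℤ.+ j) ≈ fromℤ i + fromℤ j
  fromℤ-+ (+ m)    (+ n)    = ×-homo-+ 1# m n
  fromℤ-+ (+ m)    -[1+ n ] = fromℤ-⊖ m (suc n)
  fromℤ-+ -[1+ m ] (+ n)    = trans (fromℤ-⊖ n (suc m)) (+-comm _ _)
  fromℤ-+ -[1+ m ] -[1+ n ] = begin
    - (suc (suc (m ℕ.+ n)) × 1#)       ≡⟨ ≡.cong (λ k → - (k × 1#)) (ℕ.+-suc (suc m) n) ⟨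
    - ((suc m ℕ.+ suc n) × 1#)         ≈⟨ -‿cong (×-homo-+ 1# (suc m) (suc n)) ⟩
    - (suc m × 1# + suc n × 1#)        ≈⟨ -‿+-comm _ _ ⟨
    - (suc m × 1#) + - (suc n × 1#)    ∎

  fromℤ-neg : ∀ i → fromℤ (ℤ.- i) ≈ - fromℤ i
  fromℤ-neg (+ zero)  = sym -0#≈0#
  fromℤ-neg (+ suc n) = refl
  fromℤ-neg -[1+ n ]  = sym (-‿involutive _)

  fromℤ-+◃ : ∀ n → fromℤ (Sign.+ ◃ n) ≈ n × 1#
  fromℤ-+◃ zero    = refl
  fromℤ-+◃ (suc n) = refl

  fromℤ--◃ : ∀ n → fromℤ (Sign.- ◃ n) ≈ - (n × 1#)
  fromℤ--◃ zero    = sym -0#≈0#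
  fromℤ--◃ (suc n) = refl

  fromℤ-* : ∀ i j → fromℤ (i ℤ.* j) ≈ fromℤ i * fromℤ j
  fromℤ-* (+ m) (+ n) = trans (fromℤ-+◃ (m ℕ.* n)) (×1-homo-* m n)
  fromℤ-* (+ m) -[1+ n ] = begin
    fromℤ (Sign.- ◃ (m ℕ.* suc n))     ≈⟨ fromℤ--◃ (m ℕ.* suc n) ⟩
    - ((m ℕ.* suc n) × 1#)             ≈⟨ -‿cong (×1-homo-* m (suc n)) ⟩
    - (m × 1# * suc n × 1#)            ≈⟨ -‿distribʳ-* _ _ ⟩
    m × 1# * - (suc n × 1#)            ∎
  fromℤ-* -[1+ m ] (+ n) = begin
    fromℤ (Sign.- ◃ (suc m ℕ.* n))     ≈⟨ fromℤ--◃ (suc m ℕ.* n) ⟩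
    - ((suc m ℕ.* n) × 1#)             ≈⟨ -‿cong (×1-homo-* (suc m) n) ⟩
    - (suc m × 1# * n × 1#)            ≈⟨ -‿distribˡ-* _ _ ⟩
    - (suc m × 1#) * n × 1#            ∎
  fromℤ-* -[1+ m ] -[1+ n ] = begin
    (suc m ℕ.* suc n) × 1#             ≈⟨ ×1-homo-* (suc m) (suc n) ⟩
    suc m × 1# * suc n × 1#            ≈⟨ -‿involutive _ ⟨
    - - (suc m × 1# * suc n × 1#)      ≈⟨ -‿cong (-‿distribˡ-* _ _) ⟩
    - (- (suc m × 1#) * suc n × 1#)    ≈⟨ -‿distribʳ-* _ _ ⟩
    - (suc m × 1#) * - (suc n × 1#)    ∎

  fromℤ-morphism : ℤ.+-*-rawRing -Raw-AlmostCommutative⟶ fromCommutativeRing F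
  fromℤ-morphism = record
    { ⟦_⟧    = fromℤ
    ; +-homo = fromℤ-+
    ; *-homo = fromℤ-*
    ; -‿homo = fromℤ-neg
    ; 0-homo = refl
    ; 1-homo = +-identityʳ 1#
    }

  fromℤ-≟ : ∀ i j → Maybe (fromℤ i ≈ fromℤ j)
  fromℤ-≟ i j with i ℤ.≟ j
  ... | yes ≡.refl = just refl
  ... | no _       = nothing

  open import Algebra.Solver.Ring ℤ.+-*-rawRing (fromCommutativeRing F) fromℤ-morphism fromℤ-≟ public

  :0 : ∀ {n} → Polynomial n
  :0 = con (+ 0)

module PowProperties {c ℓ} (F : CommutativeRing c ℓ) where

  open CommutativeRing F
  open import Algebra.Properties.Semiring.Exp semiring
    using (^-congˡ; ^-homo-*; ^-assocʳ) renaming (_^_ to _^ᴿ_)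
  open import Algebra.Properties.CommutativeSemiring.Exp commutativeSemiring using (^-distrib-*)
  open import Relation.Binary.Reasoning.Setoid setoid

  pow≡^ : ∀ x n → pow F x n ≡.≡ x ^ᴿ n
  pow≡^ x zero    = ≡.refl
  pow≡^ x (suc n) = ≡.cong (x *_) (pow≡^ x n)

  pow-congˡ : ∀ {x y} n → x ≈ y → pow F x n ≈ pow F y n
  pow-congˡ {x} {y} n rewrite pow≡^ x n | pow≡^ y n = ^-congˡ n

  pow-+ : ∀ x m n → pow F x (m ℕ.+ n) ≈ pow F x m * pow F x n
  pow-+ x m n rewrite pow≡^ x (m ℕ.+ n) | pow≡^ x m | pow≡^ x n = ^-homo-* x m n

  pow-* : ∀ x m n → pow F x (m ℕ.* n) ≈ pow F (pow F x m) n
  pow-* x m n rewrite pow≡^ x (m ℕ.* n) | pow≡^ (pow F x m) n | pow≡^ x m = sym (^-assocʳ x m n)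

  pow-distrib-* : ∀ x y n → pow F (x * y) n ≈ pow F x n * pow F y n
  pow-distrib-* x y n rewrite pow≡^ (x * y) n | pow≡^ x n | pow≡^ y n = ^-distrib-* x y n

  pow-1# : ∀ n → pow F 1# n ≈ 1#
  pow-1# zero    = refl
  pow-1# (suc n) = trans (*-identityˡ _) (pow-1# n)

  pow-^3 : ∀ x n → pow F x (n ^ 3) ≈ pow F (pow F (pow F x n) n) n
  pow-^3 x n = begin
    pow F x (n ℕ.* (n ℕ.* (n ℕ.* 1)))       ≈⟨ pow-* x n (n ℕ.* (n ℕ.* 1)) ⟩
    pow F (pow F x n) (n ℕ.* (n ℕ.* 1))     ≈⟨ pow-* (pow F x n) n (n ℕ.* 1) ⟩
    pow F (pow F (pow F x n) n) (n ℕ.* 1)   ≡⟨ ≡.cong (pow F (pow F (pow F x n) n)) (ℕ.*-identityʳ n) ⟩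
    pow F (pow F (pow F x n) n) n           ∎

module _ {c ℓ} (F : CommutativeRing c ℓ) where

  open CommutativeRing F

  PowAdditive : ℕ → Set (c ⊔ ℓ)
  PowAdditive n = ∀ x y → pow F (x + y) n ≈ pow F x n + pow F y n

  PowIdentity : ℕ → Set (c ⊔ ℓ)
  PowIdentity n = ∀ x → pow F x n ≈ x

module FieldProperties {c ℓ} (F : CommutativeRing c ℓ) (isField : IsField F) where

  open CommutativeRing F
  open IsField isField public
  open import Algebra.Properties.Ring ring using (x∙y⁻¹≈ε⇒x≈y; x≈y⇒x∙y⁻¹≈ε; x[y-z]≈xy-xz)
  open import Relation.Binary.Reasoning.Setoid setoid

  _⁻¹[_] : ∀ x → x ≉ 0# → Carrier
  x ⁻¹[ x≉0 ] = proj₁ (inverse x x≉0)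

  x*x⁻¹≈1 : ∀ x (x≉0 : x ≉ 0#) → x * x ⁻¹[ x≉0 ] ≈ 1#
  x*x⁻¹≈1 x x≉0 = proj₂ (inverse x x≉0)

  x-y≈0⇒x≈y : ∀ {x y} → x - y ≈ 0# → x ≈ y
  x-y≈0⇒x≈y = x∙y⁻¹≈ε⇒x≈y _ _

  x≈t*y⇒y≈t⁻¹*x : ∀ {t x y} (t≉0 : t ≉ 0#) → x ≈ t * y → y ≈ t ⁻¹[ t≉0 ] * x
  x≈t*y⇒y≈t⁻¹*x {t} {x} {y} t≉0 x≈ty = begin
    y                    ≈⟨ *-identityˡ y ⟨
    1# * y               ≈⟨ *-congʳ (trans (*-comm t⁻¹ t) (x*x⁻¹≈1 t t≉0)) ⟨
    (t⁻¹ * t) * y        ≈⟨ *-assoc t⁻¹ t y ⟩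
    t⁻¹ * (t * y)        ≈⟨ *-congˡ x≈ty ⟨
    t⁻¹ * x              ∎
    where t⁻¹ = t ⁻¹[ t≉0 ]

  x*y≈0⇒y≈0 : ∀ {x y} → x ≉ 0# → x * y ≈ 0# → y ≈ 0#
  x*y≈0⇒y≈0 {x} {y} x≉0 xy≈0 = begin
    y                    ≈⟨ x≈t*y⇒y≈t⁻¹*x x≉0 (sym xy≈0) ⟩
    x ⁻¹[ x≉0 ] * 0#     ≈⟨ zeroʳ _ ⟩
    0#                   ∎

  *-cancelˡ-≉0 : ∀ {x y z} → x ≉ 0# → x * y ≈ x * z → y ≈ z
  *-cancelˡ-≉0 {x} {y} {z} x≉0 xy≈xz =
    x-y≈0⇒x≈y (x*y≈0⇒y≈0 x≉0 (trans (x[y-z]≈xy-xz x y z) (x≈y⇒x∙y⁻¹≈ε xy≈xz)))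

  x*y≉0 : ∀ {x y} → x ≉ 0# → y ≉ 0# → x * y ≉ 0#
  x*y≉0 x≉0 y≉0 xy≈0 = y≉0 (x*y≈0⇒y≈0 x≉0 xy≈0)

  x⁻¹≉0 : ∀ x (x≉0 : x ≉ 0#) → x ⁻¹[ x≉0 ] ≉ 0#
  x⁻¹≉0 x x≉0 x⁻¹≈0 = 1≉0 (trans (sym (x*x⁻¹≈1 x x≉0)) (trans (*-congˡ x⁻¹≈0) (zeroʳ x)))

  pow≉0 : ∀ {x} n → x ≉ 0# → pow F x n ≉ 0#
  pow≉0 zero    x≉0 = 1≉0
  pow≉0 (suc n) x≉0 = x*y≉0 x≉0 (pow≉0 n x≉0)

  pow≈0⇒x≈0 : ∀ {x} n → pow F x n ≈ 0# → x ≈ 0#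
  pow≈0⇒x≈0 {x} n xⁿ≈0 with dec x 0#
  ... | yes x≈0 = x≈0
  ... | no  x≉0 = ⊥-elim (pow≉0 n x≉0 xⁿ≈0)

module FiniteField {c ℓ} (F : CommutativeRing c ℓ) (isField : IsField F) {N : ℕ} (size : HasSize F N) where

  open CommutativeRing F
  open RingSolver F
  open import Algebra.Bundles using (CommutativeMonoid)
  open import Algebra.Structures using (IsCommutativeMonoid)
  open import Data.Fin using (Fin)
  open import Data.Fin.Permutation using (Permutation; permutation)
  open import Data.Vec.Functional using (replicate)
  open import Function.Bundles using (Inverse)
  open import Function.Properties.Bijection using (Bijection⇒Inverse)
  import Function.Construct.Symmetry as Symmetry
  open import Algebra.Properties.Semiring.Mult semiring using (_×_)
  open import Algebra.Properties.Ring ring using (+-identityˡ-unique)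
  open import Relation.Binary.Reasoning.Setoid setoid

  private
    enumeration : Inverse (≡.setoid (Fin N)) setoid
    enumeration = Symmetry.inverse (Bijection⇒Inverse size)

  element : Fin N → Carrier
  element = Inverse.to enumeration

  index : Carrier → Fin N
  index = Inverse.from enumeration

  index-cong : ∀ {x y} → x ≈ y → index x ≡.≡ index y
  index-cong = Inverse.from-cong enumeration

  element-index : ∀ x → element (index x) ≈ x
  element-index x = Inverse.inverseˡ enumeration ≡.refl

  index-element : ∀ i → index (element i) ≡.≡ i
  index-element i = Inverse.inverseʳ enumeration refl

  relabelling : (f g : Carrier → Carrier) → (∀ {x y} → x ≈ y → f x ≈ f y) → (∀ {x y} → x ≈ y → g x ≈ g y) →
                (∀ x → f (g x) ≈ x) → (∀ x → g (f x) ≈ x) → Permutation N N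
  relabelling f g f-cong g-cong fg≈id gf≈id =
    permutation (λ i → index (f (element i))) (λ i → index (g (element i)))
                (cancel f g f-cong fg≈id) (cancel g f g-cong gf≈id)
    where
    cancel : ∀ f g → (∀ {x y} → x ≈ y → f x ≈ f y) → (∀ x → f (g x) ≈ x) →
             ∀ i → index (f (element (index (g (element i))))) ≡.≡ i
    cancel f g f-cong fg≈id i =
      ≡.trans (index-cong (trans (f-cong (element-index _)) (fg≈id _))) (index-element i)

  module _ {_∙_ ε} (isCommutativeMonoid : IsCommutativeMonoid _≈_ _∙_ ε) where

    private
      monoid : CommutativeMonoid c ℓ
      monoid = record { isCommutativeMonoid = isCommutativeMonoid }

    open import Algebra.Properties.CommutativeMonoid.Sum monoid using (sum; sum-permute; sum-cong-≋)

    fold-invariant : ∀ (h f g : Carrier → Carrier) → (∀ {x y} → x ≈ y → h x ≈ h y) →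
                     (∀ {x y} → x ≈ y → f x ≈ f y) → (∀ {x y} → x ≈ y → g x ≈ g y) →
                     (∀ x → f (g x) ≈ x) → (∀ x → g (f x) ≈ x) →
                     sum (h ∘ element) ≈ sum (h ∘ f ∘ element)
    fold-invariant h f g h-cong f-cong g-cong fg≈id gf≈id = trans
      (sum-permute (h ∘ element) (relabelling f g f-cong g-cong fg≈id gf≈id))
      (sum-cong-≋ (λ i → h-cong (element-index (f (element i)))))

  open import Algebra.Properties.CommutativeMonoid.Sum +-commutativeMonoid
    using (sum; ∑-distrib-+; sum-replicate)

  size×x≈0 : ∀ a → N × a ≈ 0#
  size×x≈0 a = +-identityˡ-unique (N × a) (sum element) (begin
    N × a + sum element                ≈⟨ +-congʳ (sum-replicate N) ⟨
    sum (replicate N a) + sum element  ≈⟨ ∑-distrib-+ (replicate N a) element ⟨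
    sum (λ i → a + element i)          ≈⟨ fold-invariant +-isCommutativeMonoid (λ x → x) (a +_) (- a +_)
                                            (λ x≈y → x≈y) +-congˡ +-congˡ
                                            (solve 2 (λ a x → a :+ (:- a :+ x) := x) refl a)
                                            (solve 2 (λ a x → :- a :+ (a :+ x) := x) refl a) ⟨
    sum element                        ∎)

module Fermat {c ℓ} (F : CommutativeRing c ℓ) (isField : IsField F) {M : ℕ} (size : HasSize F (suc M)) where

  open CommutativeRing F
  open FieldProperties F isField
  open PowProperties F
  open FiniteField F isField size
    using (element; index; index-cong; index-element; element-index; fold-invariant)
  open import Data.Fin as Fin using (Fin)
  open import Data.Fin.Properties using (punchInᵢ≢i)
  open import Data.Vec.Functional using (replicate)
  open import Algebra.Properties.CommutativeMonoid.Sum *-commutativeMonoid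
    using (∑-distrib-+; sum-replicate; sum-remove; sum-cong-≋) renaming (sum to ∏)
  open import Algebra.Properties.Semiring.Exp semiring using () renaming (_^_ to _^ᴿ_)
  open import Relation.Binary.Reasoning.Setoid setoid

  -- unit replaces 0 by 1, so that the product of unit over F is the product of its nonzero elements.
  unit : Carrier → Carrier
  unit y with dec y 0#
  ... | yes _ = 1#
  ... | no  _ = y

  unit-0 : ∀ {y} → y ≈ 0# → unit y ≈ 1#
  unit-0 {y} y≈0 with dec y 0#
  ... | yes _   = refl
  ... | no  y≉0 = ⊥-elim (y≉0 y≈0)

  unit-≉0 : ∀ {y} → y ≉ 0# → unit y ≈ y
  unit-≉0 {y} y≉0 with dec y 0#
  ... | yes y≈0 = ⊥-elim (y≉0 y≈0)
  ... | no  _   = refl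

  unit≉0 : ∀ y → unit y ≉ 0#
  unit≉0 y with dec y 0#
  ... | yes _   = 1≉0
  ... | no  y≉0 = y≉0

  unit-cong : ∀ {y z} → y ≈ z → unit y ≈ unit z
  unit-cong {y} {z} y≈z with dec y 0# | dec z 0#
  ... | yes _   | yes _   = refl
  ... | yes y≈0 | no  z≉0 = ⊥-elim (z≉0 (trans (sym y≈z) y≈0))
  ... | no  y≉0 | yes z≈0 = ⊥-elim (y≉0 (trans y≈z z≈0))
  ... | no  _   | no  _   = y≈z

  ∏≉0 : ∀ {n} (f : Fin n → Carrier) → (∀ i → f i ≉ 0#) → ∏ f ≉ 0#
  ∏≉0 {zero}  f f≉0 = 1≉0
  ∏≉0 {suc n} f f≉0 = x*y≉0 (f≉0 Fin.zero) (∏≉0 (f ∘ Fin.suc) (f≉0 ∘ Fin.suc))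

  ∏-scale : ∀ {n} x (f : Fin n → Carrier) → ∏ (λ i → x * f i) ≈ pow F x n * ∏ f
  ∏-scale {n} x f = begin
    ∏ (λ i → x * f i)              ≈⟨ ∑-distrib-+ (replicate n x) f ⟩
    ∏ (replicate n x) * ∏ f        ≈⟨ *-congʳ (sum-replicate n) ⟩
    x ^ᴿ n * ∏ f                   ≡⟨ ≡.cong (_* ∏ f) (pow≡^ x n) ⟨
    pow F x n * ∏ f                ∎

  zeroIndex : Fin (suc M)
  zeroIndex = index 0#

  nonzeroElement : Fin M → Carrier
  nonzeroElement j = element (Fin.punchIn zeroIndex j)

  nonzeroElement≉0 : ∀ j → nonzeroElement j ≉ 0#
  nonzeroElement≉0 j e≈0 = punchInᵢ≢i zeroIndex j (≡.trans (≡.sym (index-element _)) (index-cong e≈0))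

  ∏-unit-scaled : ∀ {x} → x ≉ 0# → ∏ (unit ∘ (x *_) ∘ element) ≈ pow F x M * ∏ (unit ∘ nonzeroElement)
  ∏-unit-scaled {x} x≉0 = begin
    ∏ (unit ∘ (x *_) ∘ element)        ≈⟨ sum-remove {i = zeroIndex} (unit ∘ (x *_) ∘ element) ⟩
    unit (x * element zeroIndex) * ∏ (unit ∘ (x *_) ∘ nonzeroElement)
      ≈⟨ *-cong (unit-0 (trans (*-congˡ (element-index 0#)) (zeroʳ x))) (sum-cong-≋ unit-scaled) ⟩
    1# * ∏ (λ j → x * unit (nonzeroElement j))     ≈⟨ *-identityˡ _ ⟩
    ∏ (λ j → x * unit (nonzeroElement j))          ≈⟨ ∏-scale x (unit ∘ nonzeroElement) ⟩
    pow F x M * ∏ (unit ∘ nonzeroElement)          ∎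
    where
    unit-scaled : ∀ j → unit (x * nonzeroElement j) ≈ x * unit (nonzeroElement j)
    unit-scaled j = trans (unit-≉0 (x*y≉0 x≉0 (nonzeroElement≉0 j)))
                          (*-congˡ (sym (unit-≉0 (nonzeroElement≉0 j))))

  ∏-unit-invariant : ∀ {x} → x ≉ 0# → ∏ (unit ∘ (x *_) ∘ element) ≈ ∏ (unit ∘ element)
  ∏-unit-invariant {x} x≉0 = sym (fold-invariant *-isCommutativeMonoid unit (x *_) (x⁻¹ *_)
    unit-cong *-congˡ *-congˡ (cancel (x*x⁻¹≈1 x x≉0)) (cancel (trans (*-comm x⁻¹ x) (x*x⁻¹≈1 x x≉0))))
    where
    x⁻¹ = x ⁻¹[ x≉0 ]
    cancel : ∀ {a b} → a * b ≈ 1# → ∀ y → a * (b * y) ≈ y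
    cancel ab≈1 y = trans (sym (*-assoc _ _ y)) (trans (*-congʳ ab≈1) (*-identityˡ y))

  x^[size-1]≈1 : ∀ {x} → x ≉ 0# → pow F x M ≈ 1#
  x^[size-1]≈1 {x} x≉0 = sym (*-cancelˡ-≉0 (∏≉0 _ (unit≉0 ∘ nonzeroElement)) (begin
    W * 1#                             ≈⟨ *-comm W 1# ⟩
    1# * W                             ≈⟨ *-congʳ (pow-1# M) ⟨
    pow F 1# M * W                     ≈⟨ ∏-unit-scaled 1≉0 ⟨
    ∏ (unit ∘ (1# *_) ∘ element)       ≈⟨ ∏-unit-invariant 1≉0 ⟩
    ∏ (unit ∘ element)                 ≈⟨ ∏-unit-invariant x≉0 ⟨
    ∏ (unit ∘ (x *_) ∘ element)        ≈⟨ ∏-unit-scaled x≉0 ⟩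
    pow F x M * W                      ≈⟨ *-comm _ W ⟩
    W * pow F x M                      ∎))
    where W = ∏ (unit ∘ nonzeroElement)

  x^size≈x : PowIdentity F (suc M)
  x^size≈x x with dec x 0#
  ... | yes x≈0 = trans (*-congʳ x≈0) (trans (zeroˡ _) (sym x≈0))
  ... | no  x≉0 = trans (*-congˡ (x^[size-1]≈1 x≉0)) (*-identityʳ x)

module _ {c ℓ} (F : CommutativeRing c ℓ) (isField : IsField F) where

  open CommutativeRing F
  open FieldProperties F isField
  open import Algebra.Properties.Semiring.Mult semiring using (_×_; ×1-homo-*)

  x^size≈x : ∀ {N} → HasSize F N → PowIdentity F N
  x^size≈x {zero}  size with Bijection.to size 0#
  ... | ()
  x^size≈x {suc M} size = Fermat.x^size≈x F isField size

  pow-×1 : ∀ n m → pow F (n × 1#) m ≈ (n ^ m) × 1#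
  pow-×1 n zero    = sym (+-identityʳ 1#)
  pow-×1 n (suc m) = trans (*-congˡ (pow-×1 n m)) (sym (×1-homo-* n (n ^ m)))

  p^m-elements⇒p×1≈0 : ∀ p m → HasSize F (p ^ m) → p × 1# ≈ 0#
  p^m-elements⇒p×1≈0 p m size = pow≈0⇒x≈0 m (trans (pow-×1 p m) (FiniteField.size×x≈0 F isField size 1#))

module _ where

  open import Data.Nat
  open import Data.Nat.Properties
  open import Data.Nat.Divisibility
  open import Data.Nat.Primality
  open import Data.Nat.Combinatorics
  open import Data.Nat.DivMod using (m*[n/m]≡n)
  open import Data.Sum using (inj₁; inj₂)
  open import Relation.Nullary using (contradiction)
  open import Relation.Binary.PropositionalEquality

  prime∤factorial : ∀ {p} → Prime p → ∀ {n} → n < p → ¬ p ∣ n !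
  prime∤factorial (prime _) {zero} _ p∣1 = nonTrivial⇒≢1 (∣1⇒≡1 p∣1)
  prime∤factorial p-prime {suc n} n<p p∣[1+n]! with euclidsLemma (suc n) (n !) p-prime p∣[1+n]!
  ... | inj₁ p∣1+n = <⇒≱ n<p (∣⇒≤ p∣1+n)
  ... | inj₂ p∣n!  = prime∤factorial p-prime (<-trans (n<1+n n) n<p) p∣n!

  n∣n! : ∀ n → .{{NonZero n}} → n ∣ n !
  n∣n! (suc n) = m∣m*n (n !)

  prime∣binomial : ∀ {p k} → Prime p → 0 < k → k < p → p ∣ p C k
  prime∣binomial {p} {k} p-prime 0<k k<p
    with euclidsLemma (p C k) (k ! * (p ∸ k) !) p-prime p∣C*k![p∸k]!
    where
    instance _ = k !* (p ∸ k) !≢0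
    k![p∸k]!*C≡p! : (k ! * (p ∸ k) !) * (p C k) ≡ p !
    k![p∸k]!*C≡p! = trans (cong ((k ! * (p ∸ k) !) *_) (nCk≡n!/k![n-k]! (<⇒≤ k<p)))
                          (m*[n/m]≡n (k![n∸k]!∣n! (<⇒≤ k<p)))
    p∣C*k![p∸k]! : p ∣ (p C k) * (k ! * (p ∸ k) !)
    p∣C*k![p∸k]! = subst (p ∣_) (trans (sym k![p∸k]!*C≡p!) (*-comm _ (p C k))) (n∣n! p {{prime⇒nonZero p-prime}})
  ... | inj₁ p∣C = p∣C
  ... | inj₂ p∣k!*[p∸k]! with euclidsLemma (k !) ((p ∸ k) !) p-prime p∣k!*[p∸k]!
  ...   | inj₁ p∣k!     = contradiction p∣k! (prime∤factorial p-prime k<p)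
  ...   | inj₂ p∣[p∸k]! = contradiction p∣[p∸k]! (prime∤factorial p-prime (∸-monoʳ-< 0<k (<⇒≤ k<p)))

module _ {c ℓ} (F : CommutativeRing c ℓ) where

  open CommutativeRing F
  open PowProperties F
  open import Data.Nat using (_<_; s≤s; z≤n)
  open import Data.Nat.Divisibility using (_∣_; divides)
  open import Data.Nat.Combinatorics using (_C_; nCn≡1)
  open import Data.Fin as Fin using (inject₁)
  import Data.Fin.Properties as Fin
  open import Data.Vec.Functional using (tail; init; last)
  open import Algebra.Properties.Semiring.Mult semiring using (_×_; ×-congʳ; ×-assoc-*; ×1-homo-*)
  open import Algebra.Properties.Semiring.Exp semiring using () renaming (_^_ to _^ᴿ_)
  open import Algebra.Properties.Monoid.Sum +-monoid using (sum; sum-init-last; sum-cong-≋; sum-replicate-zero)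
  open import Algebra.Properties.CommutativeSemiring.Binomial commutativeSemiring
    using (theorem; binomialTerm; binomial)
  open import Relation.Binary.Reasoning.Setoid setoid

  multiple-of-char≈0 : ∀ {p} → p × 1# ≈ 0# → ∀ {n} → p ∣ n → ∀ z → n × z ≈ 0#
  multiple-of-char≈0 {p} p×1≈0 (divides d ≡.refl) z = begin
    (d ℕ.* p) × z                 ≈⟨ ×-congʳ (d ℕ.* p) (*-identityˡ z) ⟨
    (d ℕ.* p) × (1# * z)          ≈⟨ ×-assoc-* (d ℕ.* p) 1# z ⟨
    ((d ℕ.* p) × 1#) * z          ≈⟨ *-congʳ (×1-homo-* d p) ⟩
    ((d × 1#) * (p × 1#)) * z     ≈⟨ *-congʳ (*-congˡ p×1≈0) ⟩
    ((d × 1#) * 0#) * z           ≈⟨ *-congʳ (zeroʳ _) ⟩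
    0# * z                        ≈⟨ zeroˡ z ⟩
    0#                            ∎

  -- In the binomial expansion of (x + y) ^ p only the two outer coefficients are not divisible by p.
  frobenius-+ : ∀ {p} → Prime p → p × 1# ≈ 0# → PowAdditive F p
  frobenius-+ {suc n} p-prime p×1≈0 x y
    rewrite pow≡^ (x + y) (suc n) | pow≡^ x (suc n) | pow≡^ y (suc n) = begin
      (x + y) ^ᴿ p                                        ≈⟨ theorem p x y ⟩
      t Fin.zero + sum (tail t)                           ≈⟨ +-congˡ (sum-init-last (tail t)) ⟩
      t Fin.zero + (sum (init (tail t)) + last (tail t))
        ≈⟨ +-cong first (+-cong (trans (sum-cong-≋ middle) (sum-replicate-zero n)) final) ⟩
      y ^ᴿ p + (0# + x ^ᴿ p)                              ≈⟨ +-congˡ (+-identityˡ _) ⟩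
      y ^ᴿ p + x ^ᴿ p                                     ≈⟨ +-comm _ _ ⟩
      x ^ᴿ p + y ^ᴿ p                                     ∎
      where
      p = suc n
      t = binomialTerm x y p
      first : t Fin.zero ≈ y ^ᴿ p
      first = trans (+-identityʳ _) (*-identityˡ _)
      middle : ∀ j → init (tail t) j ≈ 0#
      middle j = multiple-of-char≈0 p×1≈0
        (prime∣binomial p-prime (s≤s z≤n) (s≤s (≡.subst (_< n) (≡.sym (Fin.toℕ-inject₁ j)) (Fin.toℕ<n j))))
        (binomial x y p (Fin.suc (inject₁ j)))
      final : last (tail t) ≈ x ^ᴿ p
      final rewrite Fin.toℕ-fromℕ n | nCn≡1 p | ℕ.n∸n≡0 p = trans (+-identityʳ _) (*-identityʳ _)

  pow-additive-* : ∀ m n → PowAdditive F m → PowAdditive F n → PowAdditive F (m ℕ.* n)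
  pow-additive-* m n m-additive n-additive x y = begin
    pow F (x + y) (m ℕ.* n)                      ≈⟨ pow-* (x + y) m n ⟩
    pow F (pow F (x + y) m) n                    ≈⟨ pow-congˡ n (m-additive x y) ⟩
    pow F (pow F x m + pow F y m) n              ≈⟨ n-additive _ _ ⟩
    pow F (pow F x m) n + pow F (pow F y m) n    ≈⟨ +-cong (pow-* x m n) (pow-* y m n) ⟨
    pow F x (m ℕ.* n) + pow F y (m ℕ.* n)        ∎

  pow-additive-^ : ∀ p → PowAdditive F p → ∀ j → PowAdditive F (p ^ j)
  pow-additive-^ p p-additive zero    x y = trans (*-identityʳ _) (sym (+-cong (*-identityʳ x) (*-identityʳ y)))
  pow-additive-^ p p-additive (suc j) = pow-additive-* p (p ^ j) p-additive (pow-additive-^ p p-additive j)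

module ProjectivePlane {c ℓ} (F : CommutativeRing c ℓ) (isField : IsField F) where

  open CommutativeRing F
  open FieldProperties F isField
  open RingSolver F
  open import Relation.Binary.Reasoning.Setoid setoid
  open import Algebra.Properties.Ring ring using (-0#≈0#)
  open import Data.Product using (_×_)

  infixl 7 _·_
  _·_ : Carrier → Triple F → Triple F
  t · (x , y , z) = (t * x , t * y , t * z)

  infix 4 _≈₃_
  _≈₃_ : Triple F → Triple F → Set ℓ
  (x , y , z) ≈₃ (x′ , y′ , z′) = x ≈ x′ × y ≈ y′ × z ≈ z′

  coord₁ coord₂ coord₃ : Triple F → Carrier
  coord₁ (x , _ , _) = x
  coord₂ (_ , y , _) = y
  coord₃ (_ , _ , z) = z

  origin : Triple F
  origin = (0# , 0# , 0#)

  dot : Triple F → Triple F → Carrier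
  dot (a , b , c) (x , y , z) = a * x + b * y + c * z

  cross : Triple F → Triple F → Triple F
  cross (a₁ , a₂ , a₃) (b₁ , b₂ , b₃) = (a₂ * b₃ - a₃ * b₂ , a₃ * b₁ - a₁ * b₃ , a₁ * b₂ - a₂ * b₁)

  -- Eliminating the third coordinate between a and c gives the point where the line ac meets m_T.
  meet : Triple F → Triple F → Triple F
  meet (a₁ , a₂ , a₃) (c₁ , c₂ , c₃) = (a₃ * c₁ - c₃ * a₁ , a₃ * c₂ - c₃ * a₂ , 0#)

  ≈₃-refl : ∀ {u} → u ≈₃ u
  ≈₃-refl = refl , refl , refl

  ≈₃-sym : ∀ {u v} → u ≈₃ v → v ≈₃ u
  ≈₃-sym (e₁ , e₂ , e₃) = sym e₁ , sym e₂ , sym e₃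

  ≈₃-trans : ∀ {u v w} → u ≈₃ v → v ≈₃ w → u ≈₃ w
  ≈₃-trans (e₁ , e₂ , e₃) (f₁ , f₂ , f₃) = trans e₁ f₁ , trans e₂ f₂ , trans e₃ f₃

  ·-congˡ : ∀ t {u v} → u ≈₃ v → t · u ≈₃ t · v
  ·-congˡ t (e₁ , e₂ , e₃) = *-congˡ e₁ , *-congˡ e₂ , *-congˡ e₃

  ·-assoc : ∀ s t u → s · (t · u) ≈₃ (s * t) · u
  ·-assoc s t (x , y , z) = sym (*-assoc s t x) , sym (*-assoc s t y) , sym (*-assoc s t z)

  ·-identity : ∀ u → 1# · u ≈₃ u
  ·-identity (x , y , z) = *-identityˡ x , *-identityˡ y , *-identityˡ z

  scalar≉0 : ∀ {u v t} → NonZeroTriple F u → u ≈₃ t · v → t ≉ 0#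
  scalar≉0 {t = t} u≉0 (e₁ , e₂ , e₃) t≈0 = u≉0 (vanish e₁ , vanish e₂ , vanish e₃)
    where
    vanish : ∀ {a b} → a ≈ t * b → a ≈ 0#
    vanish a≈tb = trans a≈tb (trans (*-congʳ t≈0) (zeroˡ _))

  ≈₃⇒proportional : ∀ {u v} → u ≈₃ v → Proportional F u v
  ≈₃⇒proportional {v = v} u≈v = 1# , 1≉0 , ≈₃-trans u≈v (≈₃-sym (·-identity v))

  proportional-trans : ∀ {u v w} → Proportional F u v → Proportional F v w → Proportional F u w
  proportional-trans {w = w} (s , s≉0 , u≈sv) (t , t≉0 , v≈tw) =
    s * t , x*y≉0 s≉0 t≉0 , ≈₃-trans u≈sv (≈₃-trans (·-congˡ s v≈tw) (·-assoc s t w))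

  proportional-sym : ∀ {u v} → Proportional F u v → Proportional F v u
  proportional-sym (t , t≉0 , e₁ , e₂ , e₃) =
    t ⁻¹[ t≉0 ] , x⁻¹≉0 t t≉0 , x≈t*y⇒y≈t⁻¹*x t≉0 e₁ , x≈t*y⇒y≈t⁻¹*x t≉0 e₂ , x≈t*y⇒y≈t⁻¹*x t≉0 e₃

  dot-· : ∀ L t v → dot L (t · v) ≈ t * dot L v
  dot-· (a , b , c) t (x , y , z) =
    solve 7 (λ a b c t x y z → a :* (t :* x) :+ b :* (t :* y) :+ c :* (t :* z)
                               := t :* (a :* x :+ b :* y :+ c :* z)) refl a b c t x y z

  dot-cong : ∀ L {u v} → u ≈₃ v → dot L u ≈ dot L v
  dot-cong L (e₁ , e₂ , e₃) = +-cong (+-cong (*-congˡ e₁) (*-congˡ e₂)) (*-congˡ e₃)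

  incident-proportional : ∀ L {u v} → Proportional F u v → dot L v ≈ 0# → dot L u ≈ 0#
  incident-proportional L {v = v} (t , _ , u≈tv) Lv≈0 =
    trans (dot-cong L u≈tv) (trans (dot-· L t v) (trans (*-congˡ Lv≈0) (zeroʳ t)))

  dot-crossˡ : ∀ u v → dot (cross u v) u ≈ 0#
  dot-crossˡ (a₁ , a₂ , a₃) (b₁ , b₂ , b₃) =
    solve 6 (λ a₁ a₂ a₃ b₁ b₂ b₃ → (a₂ :* b₃ :- a₃ :* b₂) :* a₁ :+ (a₃ :* b₁ :- a₁ :* b₃) :* a₂
                                  :+ (a₁ :* b₂ :- a₂ :* b₁) :* a₃ := :0) refl a₁ a₂ a₃ b₁ b₂ b₃

  dot-crossʳ : ∀ u v → dot (cross u v) v ≈ 0#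
  dot-crossʳ (a₁ , a₂ , a₃) (b₁ , b₂ , b₃) =
    solve 6 (λ a₁ a₂ a₃ b₁ b₂ b₃ → (a₂ :* b₃ :- a₃ :* b₂) :* b₁ :+ (a₃ :* b₁ :- a₁ :* b₃) :* b₂
                                  :+ (a₁ :* b₂ :- a₂ :* b₁) :* b₃ := :0) refl a₁ a₂ a₃ b₁ b₂ b₃

  dot-meet : ∀ L a c → dot L (meet a c) ≈ coord₃ a * dot L c - coord₃ c * dot L a
  dot-meet (l₁ , l₂ , l₃) (a₁ , a₂ , a₃) (c₁ , c₂ , c₃) =
    solve 9 (λ l₁ l₂ l₃ a₁ a₂ a₃ c₁ c₂ c₃ →
               l₁ :* (a₃ :* c₁ :- c₃ :* a₁) :+ l₂ :* (a₃ :* c₂ :- c₃ :* a₂) :+ l₃ :* :0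
               := a₃ :* (l₁ :* c₁ :+ l₂ :* c₂ :+ l₃ :* c₃) :- c₃ :* (l₁ :* a₁ :+ l₂ :* a₂ :+ l₃ :* a₃))
            refl l₁ l₂ l₃ a₁ a₂ a₃ c₁ c₂ c₃

  dot-mT : ∀ x y z → dot (mT F) (x , y , z) ≈ z
  dot-mT x y z = trans (+-cong (trans (+-cong (zeroˡ x) (zeroˡ y)) (+-identityˡ 0#)) (*-identityˡ z)) (+-identityˡ z)

  meet≈origin⇒proportional : ∀ {a c} → coord₃ a ≉ 0# → coord₃ c ≉ 0# →
                             meet a c ≈₃ origin → Proportional F c a
  meet≈origin⇒proportional {a₁ , a₂ , a₃} {c₁ , c₂ , c₃} a₃≉0 c₃≉0 (e₁ , e₂ , _) =
    c₃ * a₃⁻¹ , x*y≉0 c₃≉0 (x⁻¹≉0 a₃ a₃≉0) , solve-for e₁ , solve-for e₂ , solve-for e₃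
    where
    e₃ : a₃ * c₃ - c₃ * a₃ ≈ 0#
    e₃ = solve 2 (λ a₃ c₃ → a₃ :* c₃ :- c₃ :* a₃ := :0) refl a₃ c₃
    a₃⁻¹ = a₃ ⁻¹[ a₃≉0 ]
    solve-for : ∀ {aᵢ cᵢ} → a₃ * cᵢ - c₃ * aᵢ ≈ 0# → cᵢ ≈ (c₃ * a₃⁻¹) * aᵢ
    solve-for {aᵢ} {cᵢ} e = begin
      cᵢ                  ≈⟨ x≈t*y⇒y≈t⁻¹*x a₃≉0 (sym (x-y≈0⇒x≈y e)) ⟩
      a₃⁻¹ * (c₃ * aᵢ)    ≈⟨ solve 3 (λ a₃⁻¹ c₃ aᵢ → a₃⁻¹ :* (c₃ :* aᵢ) := (c₃ :* a₃⁻¹) :* aᵢ) refl a₃⁻¹ c₃ aᵢ ⟩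
      (c₃ * a₃⁻¹) * aᵢ    ∎

  proportional⇒meet₂≈0 : ∀ {a c} → Proportional F a c → coord₂ (meet a c) ≈ 0#
  proportional⇒meet₂≈0 {a₁ , a₂ , a₃} {c₁ , c₂ , c₃} (t , _ , _ , e₂ , e₃) = begin
    a₃ * c₂ - c₃ * a₂               ≈⟨ +-cong (*-congʳ e₃) (-‿cong (*-congˡ e₂)) ⟩
    (t * c₃) * c₂ - c₃ * (t * c₂)   ≈⟨ solve 3 (λ t c₂ c₃ → (t :* c₃) :* c₂ :- c₃ :* (t :* c₂) := :0) refl t c₂ c₃ ⟩
    0#                              ∎

  det₁₂≈0 : ∀ {L r m} → coord₁ L ≉ 0# → dot L r ≈ 0# → dot L m ≈ 0# → coord₃ r ≈ 0# → coord₃ m ≈ 0# →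
            coord₂ m * coord₁ r ≈ coord₂ r * coord₁ m
  det₁₂≈0 {L@(l₁ , l₂ , l₃)} {r@(r₁ , r₂ , r₃)} {m@(m₁ , m₂ , m₃)} l₁≉0 Lr≈0 Lm≈0 r₃≈0 m₃≈0 =
    x-y≈0⇒x≈y (x*y≈0⇒y≈0 l₁≉0 (begin
      l₁ * (m₂ * r₁ - r₂ * m₁)
        ≈⟨ solve 9 (λ l₁ l₂ l₃ r₁ r₂ r₃ m₁ m₂ m₃ →
             l₁ :* (m₂ :* r₁ :- r₂ :* m₁)
             := m₂ :* (l₁ :* r₁ :+ l₂ :* r₂ :+ l₃ :* r₃) :- r₂ :* (l₁ :* m₁ :+ l₂ :* m₂ :+ l₃ :* m₃)
                :- l₃ :* (m₂ :* r₃ :- r₂ :* m₃)) refl l₁ l₂ l₃ r₁ r₂ r₃ m₁ m₂ m₃ ⟩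
      m₂ * dot L r - r₂ * dot L m - l₃ * (m₂ * r₃ - r₂ * m₃)
        ≈⟨ +-cong (+-cong (*-congˡ Lr≈0) (-‿cong (*-congˡ Lm≈0)))
                  (-‿cong (*-congˡ (+-cong (*-congˡ r₃≈0) (-‿cong (*-congˡ m₃≈0))))) ⟩
      m₂ * 0# - r₂ * 0# - l₃ * (m₂ * 0# - r₂ * 0#)
        ≈⟨ solve 3 (λ l₃ m₂ r₂ → m₂ :* :0 :- r₂ :* :0 :- l₃ :* (m₂ :* :0 :- r₂ :* :0) := :0) refl l₃ m₂ r₂ ⟩
      0#                              ∎))

  -- ¬ (l₁ ≈ 0 × l₂ ≈ 0) says that L is not m_T, and a line other than m_T meets m_T in a single point.
  proportional-on-mT : ∀ {L r m} → ¬ (coord₁ L ≈ 0# × coord₂ L ≈ 0#) →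
                       dot L r ≈ 0# → dot L m ≈ 0# → coord₃ r ≈ 0# → coord₃ m ≈ 0# →
                       coord₂ m ≉ 0# → NonZeroTriple F r → Proportional F r m
  proportional-on-mT {L@(l₁ , l₂ , l₃)} {r@(r₁ , r₂ , r₃)} {m@(m₁ , m₂ , m₃)} L≠mT Lr≈0 Lm≈0 r₃≈0 m₃≈0 m₂≉0 r≉0 =
    t , scalar≉0 r≉0 r≈tm , r≈tm
    where
    m₂⁻¹ = m₂ ⁻¹[ m₂≉0 ]
    t = r₂ * m₂⁻¹
    r₁≈tm₁ : r₁ ≈ t * m₁
    r₁≈tm₁ with dec l₁ 0#
    ... | yes l₁≈0 = ⊥-elim (L≠mT (l₁≈0 , x*y≈0⇒y≈0 m₂≉0 m₂l₂≈0))
      where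
      m₂l₂≈0 : m₂ * l₂ ≈ 0#
      m₂l₂≈0 = begin
        m₂ * l₂                        ≈⟨ solve 6 (λ l₁ l₂ l₃ m₁ m₂ m₃ → m₂ :* l₂
                                            := (l₁ :* m₁ :+ l₂ :* m₂ :+ l₃ :* m₃) :- l₁ :* m₁ :- l₃ :* m₃)
                                          refl l₁ l₂ l₃ m₁ m₂ m₃ ⟩
        dot L m - l₁ * m₁ - l₃ * m₃    ≈⟨ +-cong (+-cong Lm≈0 (-‿cong (*-congʳ l₁≈0))) (-‿cong (*-congˡ m₃≈0)) ⟩
        0# - 0# * m₁ - l₃ * 0#         ≈⟨ solve 2 (λ m₁ l₃ → :0 :- :0 :* m₁ :- l₃ :* :0 := :0) refl m₁ l₃ ⟩
        0#                             ∎
    ... | no  l₁≉0 = begin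
      r₁                  ≈⟨ x≈t*y⇒y≈t⁻¹*x m₂≉0 (sym (det₁₂≈0 {L} {r} {m} l₁≉0 Lr≈0 Lm≈0 r₃≈0 m₃≈0)) ⟩
      m₂⁻¹ * (r₂ * m₁)    ≈⟨ solve 3 (λ m₂⁻¹ r₂ m₁ → m₂⁻¹ :* (r₂ :* m₁) := r₂ :* m₂⁻¹ :* m₁) refl m₂⁻¹ r₂ m₁ ⟩
      t * m₁              ∎
    r₂≈tm₂ : r₂ ≈ t * m₂
    r₂≈tm₂ = sym (begin
      r₂ * m₂⁻¹ * m₂      ≈⟨ *-assoc r₂ m₂⁻¹ m₂ ⟩
      r₂ * (m₂⁻¹ * m₂)    ≈⟨ *-congˡ (trans (*-comm m₂⁻¹ m₂) (x*x⁻¹≈1 m₂ m₂≉0)) ⟩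
      r₂ * 1#             ≈⟨ *-identityʳ r₂ ⟩
      r₂                  ∎)
    r≈tm : r ≈₃ t · m
    r≈tm = r₁≈tm₁ , r₂≈tm₂ , trans r₃≈0 (sym (trans (*-congˡ m₃≈0) (zeroʳ t)))

  on-line-through-meet : ∀ {L a c r} → NonZeroTriple F L → coord₃ a ≉ 0# →
                         dot L a ≈ 0# → dot L c ≈ 0# → dot L r ≈ 0# → coord₃ r ≈ 0# →
                         coord₂ (meet a c) ≉ 0# → NonZeroTriple F r → Proportional F r (meet a c)
  on-line-through-meet {L@(l₁ , l₂ , l₃)} {a@(a₁ , a₂ , a₃)} {c} L≉0 a₃≉0 La≈0 Lc≈0 Lr≈0 r₃≈0 meet₂≉0 r≉0 =
    proportional-on-mT L≠mT Lr≈0 L∋meet r₃≈0 refl meet₂≉0 r≉0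
    where
    L∋meet : dot L (meet a c) ≈ 0#
    L∋meet = trans (dot-meet L a c) (trans (+-cong (*-congˡ Lc≈0) (-‿cong (*-congˡ La≈0)))
               (solve 2 (λ a₃ c₃ → a₃ :* :0 :- c₃ :* :0 := :0) refl _ _))
    L≠mT : ¬ (l₁ ≈ 0# × l₂ ≈ 0#)
    L≠mT (l₁≈0 , l₂≈0) = L≉0 (l₁≈0 , l₂≈0 , x*y≈0⇒y≈0 a₃≉0 (begin
      a₃ * l₃                          ≈⟨ solve 6 (λ l₁ l₂ l₃ a₁ a₂ a₃ → a₃ :* l₃
                                              := (l₁ :* a₁ :+ l₂ :* a₂ :+ l₃ :* a₃) :- l₁ :* a₁ :- l₂ :* a₂)
                                            refl l₁ l₂ l₃ a₁ a₂ a₃ ⟩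
      dot L a - l₁ * a₁ - l₂ * a₂      ≈⟨ +-cong (+-cong La≈0 (-‿cong (*-congʳ l₁≈0))) (-‿cong (*-congʳ l₂≈0)) ⟩
      0# - 0# * a₁ - 0# * a₂           ≈⟨ solve 2 (λ a₁ a₂ → :0 :- :0 :* a₁ :- :0 :* a₂ := :0) refl a₁ a₂ ⟩
      0#                               ∎))

  line-through-meet : ∀ a c → coord₃ a ≉ 0# → coord₂ (meet a c) ≉ 0# →
                      Σ (Line F) λ L → dot (proj₁ L) a ≈ 0# × dot (proj₁ L) c ≈ 0# × dot (proj₁ L) (meet a c) ≈ 0#
  line-through-meet a@(a₁ , a₂ , a₃) c a₃≉0 m₂≉0 = (L , L≉0) , La≈0 , Lc≈0 , Lm≈0
    where
    m = meet a c
    m₂ = coord₂ m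
    L = cross a m
    L≉0 : NonZeroTriple F L
    L≉0 (L₁≈0 , _) = m₂≉0 (x*y≈0⇒y≈0 a₃≉0 (begin
      a₃ * m₂                     ≈⟨ solve 3 (λ a₂ a₃ m₂ → a₃ :* m₂ := :- (a₂ :* :0 :- a₃ :* m₂)) refl a₂ a₃ m₂ ⟩
      - (a₂ * 0# - a₃ * m₂)       ≈⟨ -‿cong L₁≈0 ⟩
      - 0#                        ≈⟨ -0#≈0# ⟩
      0#                          ∎))
    La≈0 : dot L a ≈ 0#
    La≈0 = dot-crossˡ a m
    Lm≈0 : dot L m ≈ 0#
    Lm≈0 = dot-crossʳ a m
    Lc≈0 : dot L c ≈ 0#
    Lc≈0 = x*y≈0⇒y≈0 a₃≉0 (begin
      a₃ * dot L c
        ≈⟨ solve 3 (λ x y c₃ → x := (x :- c₃ :* y) :+ c₃ :* y) refl (a₃ * dot L c) (dot L a) c₃ ⟩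
      (a₃ * dot L c - c₃ * dot L a) + c₃ * dot L a       ≈⟨ +-cong (trans (sym (dot-meet L a c)) Lm≈0) (*-congˡ La≈0) ⟩
      0# + c₃ * 0#                                      ≈⟨ trans (+-identityˡ _) (zeroʳ c₃) ⟩
      0#                                                ∎)
      where c₃ = coord₃ c

module FrobeniusOfOrderThree {c ℓ} (F : CommutativeRing c ℓ) (isField : IsField F) (q : ℕ)
  (q-additive : PowAdditive F q) (q³-identity : PowIdentity F (q ^ 3)) where

  open CommutativeRing F
  open FieldProperties F isField
  open PowProperties F
  open RingSolver F
  open import Algebra.Properties.Ring ring using (x+x≈x⇒x≈0; +-inverseʳ-unique)
  open import Relation.Binary.Reasoning.Setoid setoid

  φ : Carrier → Carrier
  φ x = pow F x q

  φ-cong : ∀ {x y} → x ≈ y → φ x ≈ φ y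
  φ-cong = pow-congˡ q

  φ-+ : ∀ x y → φ (x + y) ≈ φ x + φ y
  φ-+ = q-additive

  φ-* : ∀ x y → φ (x * y) ≈ φ x * φ y
  φ-* x y = pow-distrib-* x y q

  φ-1 : φ 1# ≈ 1#
  φ-1 = pow-1# q

  φ-0 : φ 0# ≈ 0#
  φ-0 = x+x≈x⇒x≈0 (φ 0#) (trans (sym (φ-+ 0# 0#)) (φ-cong (+-identityʳ 0#)))

  φ-neg : ∀ x → φ (- x) ≈ - φ x
  φ-neg x = +-inverseʳ-unique (φ x) (φ (- x)) (trans (sym (φ-+ x (- x))) (trans (φ-cong (-‿inverseʳ x)) φ-0))

  φ-sub : ∀ x y → φ (x - y) ≈ φ x - φ y
  φ-sub x y = trans (φ-+ x (- y)) (+-congˡ (φ-neg y))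

  φ³≈id : ∀ x → φ (φ (φ x)) ≈ x
  φ³≈id x = trans (sym (pow-^3 x q)) (q³-identity x)

  φ≉0 : ∀ {x} → x ≉ 0# → φ x ≉ 0#
  φ≉0 = pow≉0 q

  φ-inverse : ∀ {x y} → x * y ≈ 1# → φ x * φ y ≈ 1#
  φ-inverse {x} {y} xy≈1 = trans (sym (φ-* x y)) (trans (φ-cong xy≈1) φ-1)

  pow-q*q : ∀ x → pow F x (q ℕ.* q) ≈ φ (φ x)
  pow-q*q x = pow-* x q q

  pow-q+1 : ∀ x → pow F x (q ℕ.+ 1) ≈ φ x * x
  pow-q+1 x = trans (pow-+ x q 1) (*-congˡ (*-identityʳ x))

  norm : Carrier → Carrier
  norm x = x * φ x * φ (φ x)

  Norm≈norm : ∀ x → Norm F q x ≈ norm x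
  Norm≈norm x = begin
    pow F x (q ℕ.* q ℕ.+ q ℕ.+ 1)        ≈⟨ pow-+ x (q ℕ.* q ℕ.+ q) 1 ⟩
    pow F x (q ℕ.* q ℕ.+ q) * pow F x 1  ≈⟨ *-cong (pow-+ x (q ℕ.* q) q) (*-identityʳ x) ⟩
    pow F x (q ℕ.* q) * φ x * x          ≈⟨ *-congʳ (*-congʳ (pow-q*q x)) ⟩
    φ (φ x) * φ x * x                    ≈⟨ solve 3 (λ a b c → a :* b :* c := c :* b :* a) refl (φ (φ x)) (φ x) x ⟩
    norm x                               ∎

  norm-cong : ∀ {x y} → x ≈ y → norm x ≈ norm y
  norm-cong x≈y = *-cong (*-cong x≈y (φ-cong x≈y)) (φ-cong (φ-cong x≈y))

  norm-* : ∀ x y → norm (x * y) ≈ norm x * norm y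
  norm-* x y = begin
    x * y * φ (x * y) * φ (φ (x * y))
      ≈⟨ *-cong (*-congˡ (φ-* x y)) (trans (φ-cong (φ-* x y)) (φ-* (φ x) (φ y))) ⟩
    x * y * (φ x * φ y) * (φ (φ x) * φ (φ y))
      ≈⟨ solve 6 (λ x y φx φy φ²x φ²y → x :* y :* (φx :* φy) :* (φ²x :* φ²y)
                                        := x :* φx :* φ²x :* (y :* φy :* φ²y))
               refl x y (φ x) (φ y) (φ (φ x)) (φ (φ y)) ⟩
    norm x * norm y  ∎

  norm-neg : ∀ x → norm (- x) ≈ - norm x
  norm-neg x = begin
    - x * φ (- x) * φ (φ (- x))          ≈⟨ *-cong (*-congˡ (φ-neg x)) (trans (φ-cong (φ-neg x)) (φ-neg (φ x))) ⟩
    - x * - φ x * - φ (φ x)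
      ≈⟨ solve 3 (λ a b c → :- a :* :- b :* :- c := :- (a :* b :* c)) refl x (φ x) (φ (φ x)) ⟩
    - norm x                             ∎

  norm-φ : ∀ x → norm (φ x) ≈ norm x
  norm-φ x = begin
    φ x * φ (φ x) * φ (φ (φ x))    ≈⟨ *-congˡ (φ³≈id x) ⟩
    φ x * φ (φ x) * x              ≈⟨ solve 3 (λ a b c → a :* b :* c := c :* a :* b) refl (φ x) (φ (φ x)) x ⟩
    norm x                         ∎

  φ-norm : ∀ x → φ (norm x) ≈ norm x
  φ-norm x = trans (φ-* (x * φ x) (φ (φ x))) (trans (*-congʳ (φ-* x (φ x))) (norm-φ x))

  norm≉0 : ∀ {x} → x ≉ 0# → norm x ≉ 0#
  norm≉0 x≉0 = x*y≉0 (x*y≉0 x≉0 (φ≉0 x≉0)) (φ≉0 (φ≉0 x≉0))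

  φ-*₃ : ∀ x y z → φ (x * y * z) ≈ φ x * φ y * φ z
  φ-*₃ x y z = trans (φ-* (x * y) z) (*-congʳ (φ-* x y))

  φ-fixes-inverse : ∀ {x} (x≉0 : x ≉ 0#) → φ x ≈ x → φ (x ⁻¹[ x≉0 ]) ≈ x ⁻¹[ x≉0 ]
  φ-fixes-inverse {x} x≉0 φx≈x = *-cancelˡ-≉0 x≉0 (begin
    x * φ x⁻¹        ≈⟨ *-congʳ φx≈x ⟨
    φ x * φ x⁻¹      ≈⟨ φ-inverse (x*x⁻¹≈1 x x≉0) ⟩
    1#               ≈⟨ x*x⁻¹≈1 x x≉0 ⟨
    x * x⁻¹          ∎)
    where x⁻¹ = x ⁻¹[ x≉0 ]

  -- Cramer's rule for the system obtained by applying 1, φ and φ² to the equation;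
  -- its determinant is norm a + norm b.
  semilinear-solvable : ∀ a b y → norm a + norm b ≉ 0# → ∃ λ z → a * z + b * φ z ≈ y
  semilinear-solvable a b y D≉0 = X * D⁻¹ , (begin
    a * (X * D⁻¹) + b * φ (X * D⁻¹)
      ≈⟨ +-congˡ (*-congˡ (trans (φ-* X D⁻¹) (*-cong φX≈X′ (φ-fixes-inverse D≉0 φD≈D)))) ⟩
    a * (X * D⁻¹) + b * (X′ * D⁻¹)
      ≈⟨ solve 10 (λ a φa φ²a b φb φ²b y φy φ²y D⁻¹ →
           a :* ((y :* φa :* φ²a :- b :* φ²a :* φy :+ b :* φb :* φ²y) :* D⁻¹)
           :+ b :* ((φy :* φ²a :* a :- φb :* a :* φ²y :+ φb :* φ²b :* y) :* D⁻¹)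
           := y :* (a :* φa :* φ²a :+ b :* φb :* φ²b) :* D⁻¹)
         refl a (φ a) (φ (φ a)) b (φ b) (φ (φ b)) y (φ y) (φ (φ y)) D⁻¹ ⟩
    y * D * D⁻¹                         ≈⟨ *-assoc y D D⁻¹ ⟩
    y * (D * D⁻¹)                       ≈⟨ *-congˡ (x*x⁻¹≈1 D D≉0) ⟩
    y * 1#                              ≈⟨ *-identityʳ y ⟩
    y                                   ∎)
    where
    D = norm a + norm b
    D⁻¹ = D ⁻¹[ D≉0 ]
    X  = y * φ a * φ (φ a) - b * φ (φ a) * φ y + b * φ b * φ (φ y)
    X′ = φ y * φ (φ a) * a - φ b * a * φ (φ y) + φ b * φ (φ b) * y
    φD≈D : φ D ≈ D
    φD≈D = trans (φ-+ (norm a) (norm b)) (+-cong (φ-norm a) (φ-norm b))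
    φX≈X′ : φ X ≈ X′
    φX≈X′ = begin
      φ X                                                    ≈⟨ trans (φ-+ _ _) (+-congʳ (φ-sub _ _)) ⟩
      φ (y * φ a * φ (φ a)) - φ (b * φ (φ a) * φ y) + φ (b * φ b * φ (φ y))
        ≈⟨ +-cong (+-cong (φ-*₃ _ _ _) (-‿cong (φ-*₃ _ _ _))) (φ-*₃ _ _ _) ⟩
      φ y * φ (φ a) * φ (φ (φ a)) - φ b * φ (φ (φ a)) * φ (φ y) + φ b * φ (φ b) * φ (φ (φ y))
        ≈⟨ +-cong (+-cong (*-congˡ (φ³≈id a)) (-‿cong (*-congʳ (*-congˡ (φ³≈id a))))) (*-congˡ (φ³≈id y)) ⟩
      X′                                                     ∎

module Projection {c ℓ} (F : CommutativeRing c ℓ) (isField : IsField F) (q : ℕ)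
  (q-additive : PowAdditive F q) (q³-identity : PowIdentity F (q ^ 3)) where

  open CommutativeRing F
  open FieldProperties F isField
  open RingSolver F
  open ProjectivePlane F isField
  open FrobeniusOfOrderThree F isField q q-additive q³-identity
  open import Data.Product using (_×_)
  open import Relation.Binary.Reasoning.Setoid setoid

  Π-triple : Carrier → Carrier → Triple F
  Π-triple θ r = (r * pow F θ (q ℕ.+ 1) , φ r , pow F r (q ℕ.* q) * θ)

  S-triple : Carrier → Carrier → Triple F
  S-triple θ x = (x * θ , φ x , 0#)

  chord : Carrier → Carrier → Carrier → Carrier → Carrier
  chord κ θ s r = pow F s (q ℕ.* q) * κ * φ r - pow F r (q ℕ.* q) * θ * φ s

  φ-chord : ∀ κ θ s r → φ (chord κ θ s r) ≈ s * φ κ * φ (φ r) - r * φ θ * φ (φ s)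
  φ-chord κ θ s r = begin
    φ (pow F s (q ℕ.* q) * κ * φ r - pow F r (q ℕ.* q) * θ * φ s)
      ≈⟨ trans (φ-sub _ _) (+-cong (φ-*₃ _ _ _) (-‿cong (φ-*₃ _ _ _))) ⟩
    φ (pow F s (q ℕ.* q)) * φ κ * φ (φ r) - φ (pow F r (q ℕ.* q)) * φ θ * φ (φ s)
      ≈⟨ +-cong (*-congʳ (*-congʳ (φ³ s))) (-‿cong (*-congʳ (*-congʳ (φ³ r)))) ⟩
    s * φ κ * φ (φ r) - r * φ θ * φ (φ s)  ∎
    where
    φ³ : ∀ x → φ (pow F x (q ℕ.* q)) ≈ x
    φ³ x = trans (φ-cong (pow-q*q x)) (φ³≈id x)

  meet-π : ∀ κ θ s r → meet (Π-triple κ s) (Π-triple θ r) ≈₃ (- (κ * θ) * φ (chord κ θ s r) , chord κ θ s r , 0#)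
  meet-π κ θ s r = meet₁≈ , refl , refl
    where
    meet₁≈ : pow F s (q ℕ.* q) * κ * (r * pow F θ (q ℕ.+ 1)) - pow F r (q ℕ.* q) * θ * (s * pow F κ (q ℕ.+ 1))
            ≈ - (κ * θ) * φ (chord κ θ s r)
    meet₁≈ = begin
      pow F s (q ℕ.* q) * κ * (r * pow F θ (q ℕ.+ 1)) - pow F r (q ℕ.* q) * θ * (s * pow F κ (q ℕ.+ 1))
        ≈⟨ +-cong (*-cong (*-congʳ (pow-q*q s)) (*-congˡ (pow-q+1 θ)))
                  (-‿cong (*-cong (*-congʳ (pow-q*q r)) (*-congˡ (pow-q+1 κ)))) ⟩
      φ (φ s) * κ * (r * (φ θ * θ)) - φ (φ r) * θ * (s * (φ κ * κ))
        ≈⟨ solve 8 (λ κ θ s r φκ φθ φ²s φ²r →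
             φ²s :* κ :* (r :* (φθ :* θ)) :- φ²r :* θ :* (s :* (φκ :* κ))
             := :- (κ :* θ) :* (s :* φκ :* φ²r :- r :* φθ :* φ²s))
           refl κ θ s r (φ κ) (φ θ) (φ (φ s)) (φ (φ r)) ⟩
      - (κ * θ) * (s * φ κ * φ (φ r) - r * φ θ * φ (φ s))
        ≈⟨ *-congˡ (φ-chord κ θ s r) ⟨
      - (κ * θ) * φ (chord κ θ s r)  ∎

  on-mT-in-S : ∀ k {x y} → x * y ≈ 1# → Proportional F (k * φ y , y , 0#) (S-triple k x)
  on-mT-in-S k {x} {y} xy≈1 = y * φ y , x*y≉0 y≉0 (φ≉0 y≉0) , e₁ , e₂ , sym (zeroʳ _)
    where
    y≉0 : y ≉ 0#
    y≉0 y≈0 = 1≉0 (trans (sym xy≈1) (trans (*-congˡ y≈0) (zeroʳ x)))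
    e₁ : k * φ y ≈ y * φ y * (x * k)
    e₁ = begin
      k * φ y               ≈⟨ *-identityˡ _ ⟨
      1# * (k * φ y)        ≈⟨ *-congʳ xy≈1 ⟨
      x * y * (k * φ y)     ≈⟨ solve 4 (λ x y k φy → x :* y :* (k :* φy) := y :* φy :* (x :* k)) refl x y k (φ y) ⟩
      y * φ y * (x * k)     ∎
    e₂ : y ≈ y * φ y * φ x
    e₂ = begin
      y                     ≈⟨ *-identityʳ y ⟨
      y * 1#                ≈⟨ *-congˡ (φ-inverse xy≈1) ⟨
      y * (φ x * φ y)       ≈⟨ solve 3 (λ y φx φy → y :* (φx :* φy) := y :* φy :* φx) refl y (φ x) (φ y) ⟩
      y * φ y * φ x         ∎

  Π-triple₃≉0 : ∀ {θ r} → θ ≉ 0# → r ≉ 0# → coord₃ (Π-triple θ r) ≉ 0#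
  Π-triple₃≉0 {θ} {r} θ≉0 r≉0 = x*y≉0 (pow≉0 (q ℕ.* q) r≉0) θ≉0

  projection⊆S : ∀ θ κ → θ ≉ 0# → κ ≉ 0# → ∀ P → InΠ F q κ P →
                 ∀ R → InProjection F q θ P R → InS F q (- (κ * θ)) R
  projection⊆S θ κ θ≉0 κ≉0 P (s , s≉0 , P∝A) (R , R≉0)
               (Q , (r , r≉0 , Q∝C) , P≠Q , R∈mT , (L , L≉0) , L∋P , L∋Q , L∋R) =
    B ⁻¹[ B≉0 ] , x⁻¹≉0 B B≉0 , proportional-trans R∝M M∝σ
    where
    A = Π-triple κ s
    C = Π-triple θ r
    B = chord κ θ s r
    A₃≉0 = Π-triple₃≉0 κ≉0 s≉0
    L∋A : dot L A ≈ 0#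
    L∋A = incident-proportional L (proportional-sym P∝A) L∋P
    L∋C : dot L C ≈ 0#
    L∋C = incident-proportional L (proportional-sym Q∝C) L∋Q
    B≉0 : B ≉ 0#
    B≉0 B≈0 = P≠Q (proportional-trans P∝A (proportional-trans (proportional-sym C∝A) (proportional-sym Q∝C)))
      where
      C∝A : Proportional F C A
      C∝A = meet≈origin⇒proportional A₃≉0 (Π-triple₃≉0 θ≉0 r≉0)
              (≈₃-trans (meet-π κ θ s r) (trans (*-congˡ (trans (φ-cong B≈0) φ-0)) (zeroʳ _) , B≈0 , refl))
    R∝M : Proportional F R (meet A C)
    R∝M = on-line-through-meet L≉0 A₃≉0 L∋A L∋C L∋R (trans (sym (dot-mT _ _ _)) R∈mT) B≉0 R≉0
    M∝σ : Proportional F (meet A C) (S-triple (- (κ * θ)) (B ⁻¹[ B≉0 ]))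
    M∝σ = proportional-trans (≈₃⇒proportional (meet-π κ θ s r))
            (on-mT-in-S (- (κ * θ)) (trans (*-comm _ B) (x*x⁻¹≈1 B B≉0)))

  chord-surjective : ∀ {θ κ s} → s ≉ 0# → Norm F q θ ≉ Norm F q κ →
                     ∀ {y} → y ≉ 0# → ∃ λ r → r ≉ 0# × chord κ θ s r ≈ y
  chord-surjective {θ} {κ} {s} s≉0 Nθ≉Nκ {y} y≉0 = r , φ≉0 (φ≉0 z≉0) , chord≈y
    where
    a = pow F s (q ℕ.* q) * κ
    b = - (θ * φ s)
    D≈ : norm a + norm b ≈ norm s * (norm κ - norm θ)
    D≈ = begin
      norm a + norm b
        ≈⟨ +-cong (trans (norm-* _ κ) (*-congʳ norm-s)) (trans (norm-neg _) (-‿cong (norm-* θ (φ s)))) ⟩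
      norm s * norm κ + - (norm θ * norm (φ s))
        ≈⟨ +-congˡ (-‿cong (*-congˡ (norm-φ s))) ⟩
      norm s * norm κ + - (norm θ * norm s)
        ≈⟨ solve 3 (λ ns nκ nθ → ns :* nκ :+ :- (nθ :* ns) := ns :* (nκ :- nθ)) refl (norm s) (norm κ) (norm θ) ⟩
      norm s * (norm κ - norm θ)  ∎
      where
      norm-s : norm (pow F s (q ℕ.* q)) ≈ norm s
      norm-s = trans (trans (norm-cong (pow-q*q s)) (norm-φ (φ s))) (norm-φ s)
    D≉0 : norm a + norm b ≉ 0#
    D≉0 D≈0 = x*y≉0 (norm≉0 s≉0) Nκ-Nθ≉0 (trans (sym D≈) D≈0)
      where
      Nκ-Nθ≉0 : norm κ - norm θ ≉ 0#
      Nκ-Nθ≉0 e = Nθ≉Nκ (trans (Norm≈norm θ) (trans (sym (x-y≈0⇒x≈y e)) (sym (Norm≈norm κ))))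
    z = proj₁ (semilinear-solvable a b y D≉0)
    az+bφz≈y = proj₂ (semilinear-solvable a b y D≉0)
    z≉0 : z ≉ 0#
    z≉0 z≈0 = y≉0 (trans (sym az+bφz≈y) (trans (+-cong (*-congˡ z≈0) (*-congˡ (trans (φ-cong z≈0) φ-0)))
                    (trans (+-cong (zeroʳ a) (zeroʳ b)) (+-identityˡ 0#))))
    r = φ (φ z)
    chord≈y : chord κ θ s r ≈ y
    chord≈y = begin
      a * φ r - pow F r (q ℕ.* q) * θ * φ s
        ≈⟨ +-cong (*-congˡ (φ³≈id z)) (-‿cong (*-congʳ (*-congʳ (trans (pow-q*q r) (φ³≈id (φ z)))))) ⟩
      a * z - φ z * θ * φ s
        ≈⟨ +-congˡ (solve 3 (λ φz θ φs → :- (φz :* θ :* φs) := :- (θ :* φs) :* φz) refl (φ z) θ (φ s)) ⟩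
      a * z + b * φ z                         ≈⟨ az+bφz≈y ⟩
      y                                       ∎

  S⊆projection : ∀ θ κ → θ ≉ 0# → κ ≉ 0# → Norm F q θ ≉ Norm F q κ → ∀ P → InΠ F q κ P →
                 ∀ R → InS F q (- (κ * θ)) R → InProjection F q θ P R
  S⊆projection θ κ θ≉0 κ≉0 Nθ≉Nκ P (s , s≉0 , P∝A) (R , R≉0) (x , x≉0 , R∝σ@(_ , _ , _ , _ , R₃≈t0)) =
    Q , (r , r≉0 , ≈₃⇒proportional ≈₃-refl) , P≠Q , R∈mT , L , L∋P , L∋C , L∋R
    where
    A = Π-triple κ s
    y = x ⁻¹[ x≉0 ]
    r-spec = chord-surjective s≉0 Nθ≉Nκ (x⁻¹≉0 x x≉0)
    r = proj₁ r-spec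
    r≉0 = proj₁ (proj₂ r-spec)
    B≈y : chord κ θ s r ≈ y
    B≈y = proj₂ (proj₂ r-spec)
    C = Π-triple θ r
    Q : Point F
    Q = C , λ (_ , φr≈0 , _) → φ≉0 r≉0 φr≈0
    B≉0 : chord κ θ s r ≉ 0#
    B≉0 B≈0 = x⁻¹≉0 x x≉0 (trans (sym B≈y) B≈0)
    M∝σ : Proportional F (meet A C) (S-triple (- (κ * θ)) x)
    M∝σ = proportional-trans (≈₃⇒proportional (meet-π κ θ s r))
            (on-mT-in-S (- (κ * θ)) (trans (*-congˡ B≈y) (x*x⁻¹≈1 x x≉0)))
    line = line-through-meet A C (Π-triple₃≉0 κ≉0 s≉0) B≉0
    L = proj₁ line
    L∋A = proj₁ (proj₂ line)
    L∋C = proj₁ (proj₂ (proj₂ line))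
    L∋M = proj₂ (proj₂ (proj₂ line))
    L∋P : dot (proj₁ L) (proj₁ P) ≈ 0#
    L∋P = incident-proportional (proj₁ L) P∝A L∋A
    L∋R : dot (proj₁ L) R ≈ 0#
    L∋R = incident-proportional (proj₁ L) (proportional-trans R∝σ (proportional-sym M∝σ)) L∋M
    R∈mT : dot (mT F) R ≈ 0#
    R∈mT = trans (dot-mT _ _ _) (trans R₃≈t0 (zeroʳ _))
    P≠Q : ¬ SamePoint F P Q
    P≠Q P∝C = B≉0 (proportional⇒meet₂≈0 (proportional-trans (proportional-sym P∝A) P∝C))

open CommutativeRing using (Carrier; _≈_; 0#; _*_; -_)

lemma7p2 : ∀ {c ℓ} (F : CommutativeRing c ℓ) (p k : ℕ) → Prime p →
    IsField F → HasSize F ((p ^ suc k) ^ 3) →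
    ∀ (θ κ : Carrier F) → ¬ (_≈_ F θ (0# F)) → ¬ (_≈_ F κ (0# F)) →
    ¬ (_≈_ F (Norm F (p ^ suc k) θ) (Norm F (p ^ suc k) κ)) →
    ∀ (P : Point F) → InΠ F (p ^ suc k) κ P →
    ∀ (R : Point F) →
    InProjection F (p ^ suc k) θ P R ⇔ InS F (p ^ suc k) (-_ F (_*_ F κ θ)) R
lemma7p2 F p k p-prime isField size θ κ θ≉0 κ≉0 Nθ≉Nκ P P∈Πκ R =
  mk⇔ (projection⊆S θ κ θ≉0 κ≉0 P P∈Πκ R) (S⊆projection θ κ θ≉0 κ≉0 Nθ≉Nκ P P∈Πκ R)
  where
  p×1≈0 = p^m-elements⇒p×1≈0 F isField p (suc k ℕ.* 3) (≡.subst (HasSize F) (ℕ.^-*-assoc p (suc k) 3) size)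
  q-additive = pow-additive-^ F p (frobenius-+ F p-prime p×1≈0) (suc k)
  open Projection F isField (p ^ suc k) q-additive (x^size≈x F isField size)
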